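{- For every $n\ge 1$, all $a_1,\dots,a_n,a\in\mathcal{T}$ and all formulae $\phi,\gamma_1,\dots,\gamma_n,\gamma$ of $\mathcal{L}_{\succ}$: if $\vdash_{\mathbf{LCR}}\ \rightarrow_{i=1}^{n}(\mathbf{I}_{a_i\odot b}(\gamma_i),\mathbf{I}_{a\odot b}(\gamma))$ for every $b\in\mathcal{T}$, then $\vdash_{\mathbf{LCR}}\ \rightarrow_{i=1}^{n}(\mathbf{I}_{a_i}(\phi\succ\gamma_i),\mathbf{I}_{a}(\phi\succ\gamma))$.
   Context: Fix an integer $m\ge 2$ and let $\mathcal{T}=\{0,\frac{1}{m-1},\dots,\frac{m-2}{m-1},1\}$ with its natural order. For $a,b\in\mathcal{T}$ put $a\odot b=\max\{0,a+b-1\}$. The language $\mathcal{L}_{\succ}$ has a countable set $\Pi$ of propositional variables, the unary connective $\neg$ and the binary connectives $\rightarrow$ and $\succ$; formulae are built as usual. Abbreviations: $\mathbf{t}:=p\rightarrow p$ (for a fixed variable $p$), $\phi\vee\psi:=(\phi\rightarrow\psi)\rightarrow\psi$, $\phi\wedge\psi:=\neg(\neg\phi\vee\neg\psi)$, $\phi\leftrightarrow\psi:=(\phi\rightarrow\psi)\wedge(\psi\rightarrow\phi)$. For $a\in\mathcal{T}$, $\mathbf{J}_a(\phi)$ is a fixed formula built from $\phi$ with $\neg,\rightarrow$ (the Rosser–Turquette $J$-operator of Łukasiewicz $m$-valued logic) whose value under any truth assignment is $1$ if the value of $\phi$ is $a$ and $0$ otherwise; $\mathbf{I}_a(\phi):=\mathbf{J}_a(\phi)\vee\dots\vee\mathbf{J}_1(\phi)$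 (disjunction over all $b\in\mathcal{T}$ with $b\ge a$), whose value is $1$ if the value of $\phi$ is $\ge a$ and $0$ otherwise. Iterated implication: $\rightarrow_{i=1}^{0}(\phi_i,\psi):=\psi$ and $\rightarrow_{i=1}^{k}(\phi_i,\psi):=\phi_k\rightarrow(\rightarrow_{i=1}^{k-1}(\phi_i,\psi))$. The system $\mathbf{LCR}$: all $\mathcal{L}_{\succ}$-instances of the axioms of a (complete) axiomatization of Łukasiewicz $m$-valued propositional logic $\mathbf{L}$ with modus ponens (MP), plus the axioms A1: $(\phi\succ(\psi\wedge\theta))\rightarrow((\phi\succ\psi)\wedge(\phi\succ\theta))$; A2: $((\phi\succ\psi)\wedge(\phi\succ\theta))\rightarrow(\phi\succ(\psi\wedge\theta))$; A3: $\phi\succ\mathbf{t}$; and the rules (RCEA): from $\phi\leftrightarrow\psi$ infer $(\phi\succ\theta)\leftrightarrow(\psi\succ\theta)$; (RCEC): from $\phi\leftrightarrow\psi$ infer $(\theta\succ\phi)\leftrightarrow(\theta\succ\psi)$; $(\mathrm{R}_a)$ for each $a\in\mathcal{T}$: from $\rightarrow_{i=1}^{m}(\mathbf{I}_{a_i\odot b}(\gamma_i),\mathbf{I}_{a\odot b}(\gamma))$ for every $b\in\mathcal{T}$, infer $\rightarrow_{i=1}^{m}(\mathbf{I}_{a_i}(\phi\succ\gamma_i),\mathbf{I}_{a}(\phi\succ\gamma))$, where $a_i=\frac{m-i}{m-1}$. $\vdash_{\mathbf{LCR}}\phi$ means $\phi$ is a theorem of $\mathbf{LCR}$. -}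

module Defs where

open import Data.Nat as ℕ using (ℕ; zero; suc; _∸_; _+_; _⊓_)
open import Data.Nat.Properties using (m∸n≤m; ≤-<-trans)
open import Data.Fin as Fin using (Fin; toℕ; fromℕ; fromℕ<; inject₁; opposite; _<?_)
open import Data.Fin.Properties using (toℕ<n)
open import Data.List using (List; []; _∷_; map; filter; allFin)
open import Relation.Binary.PropositionalEquality using (_≡_)
open import Relation.Nullary using (does)
open import Data.Bool using (if_then_else_)

-- Truth values: 𝒯 = {0, 1/(m-1), ..., 1}; the element k/(m-1) is
-- represented by k : Fin m.

-- a ⊙ b = max{0, a + b - 1}; on indices: (a + b) ∸ (m-1) = a ∸ ((m-1) ∸ b)
-- (valid since b ≤ m-1).
_⊙_ : {m : ℕ} → Fin m → Fin m → Fin m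
_⊙_ {m} a b = fromℕ< (≤-<-trans (m∸n≤m (toℕ a) ((m ∸ 1) ∸ toℕ b)) (toℕ<n a))

data PForm : Set where
  pvar : ℕ → PForm
  p¬   : PForm → PForm
  _p⇒_ : PForm → PForm → PForm

infixr 5 _p⇒_

_p∨_ : PForm → PForm → PForm
φ p∨ ψ = (φ p⇒ ψ) p⇒ ψ

-- Semantics in the m-valued Łukasiewicz chain, computed on numerators
-- (value k stands for k/(m-1)).
eval : (m : ℕ) → (ℕ → Fin m) → PForm → ℕ
eval m v (pvar i) = toℕ (v i)
eval m v (p¬ φ) = (m ∸ 1) ∸ eval m v φ
eval m v (φ p⇒ ψ) = (m ∸ 1) ⊓ (((m ∸ 1) ∸ eval m v φ) + eval m v ψ)

Taut : (m : ℕ) → PForm → Set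
Taut m ψ = (v : ℕ → Fin m) → eval m v ψ ≡ m ∸ 1

-- Specification of the Rosser–Turquette J-operators: J a is a formula built
-- with ¬, → (here in terms of any variables, all of which get replaced by
-- the argument φ) whose value is 1 iff the value of its argument is a, and
-- 0 otherwise.
IsJ : (m : ℕ) → (Fin m → PForm) → Set
IsJ m J = (a x : Fin m) →
  eval m (λ _ → x) (J a) ≡ (if does (a Fin.≟ x) then m ∸ 1 else 0)

data Form : Set where
  var  : ℕ → Form
  ¬_   : Form → Form
  _⇒_  : Form → Form → Form
  _≻_  : Form → Form → Form

infixr 5 _⇒_
infix 6 _≻_

subst : (ℕ → Form) → PForm → Form
subst σ (pvar i) = σ i
subst σ (p¬ φ) = ¬ subst σ φ
subst σ (φ p⇒ ψ) = subst σ φ ⇒ subst σ ψ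

𝐭 : Form
𝐭 = var 0 ⇒ var 0

_∨_ : Form → Form → Form
φ ∨ ψ = (φ ⇒ ψ) ⇒ ψ

_∧_ : Form → Form → Form
φ ∧ ψ = ¬ ((¬ φ) ∨ (¬ ψ))

_⇔_ : Form → Form → Form
φ ⇔ ψ = (φ ⇒ ψ) ∧ (ψ ⇒ φ)

infixr 4 _∨_ _∧_
infix 3 _⇔_

orList : PForm → List PForm → PForm
orList x [] = x
orList x (y ∷ ys) = x p∨ orList y ys

Ipure : (m : ℕ) → (Fin m → PForm) → Fin m → PForm
Ipure m J a = orList (J a) (map J (filter (a <?_) (allFin m)))

𝐉 : (m : ℕ) → (Fin m → PForm) → Fin m → Form → Form
𝐉 m J a φ = subst (λ _ → φ) (J a)

𝐈 : (m : ℕ) → (Fin m → PForm) → Fin m → Form → Form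
𝐈 m J a φ = subst (λ _ → φ) (Ipure m J a)

-- iterated implication →_{i=1}^{k}(φ_i, ψ); φ_i is given as φs (i-1)
impChain : (k : ℕ) → (Fin k → Form) → Form → Form
impChain zero φs ψ = ψ
impChain (suc k) φs ψ = φs (fromℕ k) ⇒ impChain k (λ i → φs (inject₁ i)) ψ

-- a_i = (m-i)/(m-1) for i = 1..m; with index j = i-1 : Fin m this is
-- the numerator m-1-j, i.e. opposite j.
aᵢ : (m : ℕ) → Fin m → Fin m
aᵢ m j = opposite j

data LCR⊢ (m : ℕ) (J : Fin m → PForm) : Form → Set where
  -- all L_≻-instances of L-tautologies (equivalently, of the axioms of a
  -- complete axiomatization of L, closed under MP)
  taut : (ψ : PForm) → Taut m ψ → (σ : ℕ → Form) → LCR⊢ m J (subst σ ψ)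
  mp   : {φ ψ : Form} → LCR⊢ m J φ → LCR⊢ m J (φ ⇒ ψ) → LCR⊢ m J ψ
  A1   : (φ ψ θ : Form) →
         LCR⊢ m J ((φ ≻ (ψ ∧ θ)) ⇒ ((φ ≻ ψ) ∧ (φ ≻ θ)))
  A2   : (φ ψ θ : Form) →
         LCR⊢ m J (((φ ≻ ψ) ∧ (φ ≻ θ)) ⇒ (φ ≻ (ψ ∧ θ)))
  A3   : (φ : Form) → LCR⊢ m J (φ ≻ 𝐭)
  RCEA : {φ ψ : Form} (θ : Form) → LCR⊢ m J (φ ⇔ ψ) →
         LCR⊢ m J ((φ ≻ θ) ⇔ (ψ ≻ θ))
  RCEC : {φ ψ : Form} (θ : Form) → LCR⊢ m J (φ ⇔ ψ) →
         LCR⊢ m J ((θ ≻ φ) ⇔ (θ ≻ ψ))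
  Ra   : (a : Fin m) (φ : Form) (γs : Fin m → Form) (γ : Form) →
         ((b : Fin m) → LCR⊢ m J
            (impChain m (λ i → 𝐈 m J (aᵢ m i ⊙ b) (γs i))
                        (𝐈 m J (a ⊙ b) γ))) →
         LCR⊢ m J
            (impChain m (λ i → 𝐈 m J (aᵢ m i) (φ ≻ γs i))
                        (𝐈 m J a (φ ≻ γ)))

-- Apart from the one application of rule (R_a), every step is an inference of
-- m-valued Łukasiewicz logic in which variables and ≻-formulae are atoms, and
-- such steps are justified semantically: if P₁, …, Pₖ ⊨ Q then the iterated
-- implication P₁ →ᴺ (… (Pₖ →ᴺ Q)) is a tautology, where N = m - 1 and P →ᴺ Q is
-- P → (P → … (P → Q)) with N arrows, so Q follows by modus ponens.
-- The n premises γᵢ with weights aᵢ are regrouped into m premises, one per truth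
-- value c: the conjunction γ̂_c of all γᵢ with aᵢ = c. The hypothesis entails the
-- premise of (R_a) for the γ̂_c, and A2, A3 give ⋀ᵢ (φ ≻ γᵢ) → φ ≻ γ̂_c, which
-- turns the conclusion of (R_a) back into the required one.
module Submission where

open import Defs
open import Data.Fin as Fin using (Fin; toℕ; fromℕ; fromℕ<; inject₁; opposite)
open import Data.Fin.Properties using (toℕ<n; toℕ-fromℕ<; toℕ-injective; opposite-involutive)
open import Data.List using (List; []; _∷_; _++_; map; filter; allFin)
open import Data.List.Membership.Propositional using (_∈_)
open import Data.List.Membership.Propositional.Properties
  using (∈-filter⁺; ∈-filter⁻; ∈-allFin; ∈-map⁺; ∈-map⁻; ∈-++⁺ˡ; ∈-++⁺ʳ)
open import Data.List.Relation.Unary.All as All using (All; []; _∷_)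
open import Data.List.Relation.Unary.All.Properties using (map⁺)
open import Data.List.Relation.Unary.Any using (here; there)
open import Data.Nat as ℕ using (ℕ; zero; suc; _+_; _∸_; _⊓_; _⊔_; _≤_; _<_; z≤n; s≤s; s≤s⁻¹; _≤?_)
open import Data.Nat.Properties
  using ( ≤-refl; ≤-total; ≤-trans; ≤-antisym; ≤-reflexive; <⇒≤; <⇒≱; ≰⇒>; ≤∧≢⇒<; m≤n⇒m<n∨m≡n; n≤1+n
        ; +-monoʳ-≤; +-monoˡ-≤; +-cancelˡ-≤; m∸n+n≡m; m∸n≤m; m∸[m∸n]≡n; ∸-+-assoc; n∸n≡0; m<n⇒0<n∸m
        ; ∸-distribˡ-⊔-⊓; m≤n⇒m⊓n≡m; m≥n⇒m⊓n≡n; m≤n⇒m⊔n≡n; m≥n⇒m⊔n≡m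
        ; m⊓n≤m; m⊓n≤n; ⊓-glb; ⊓-monoˡ-≤; ⊓-monoʳ-≤; ⊓-idem; module ≤-Reasoning)
open import Data.Product using (∃; _×_; _,_; proj₂)
open import Data.Empty using (⊥-elim)
open import Data.Sum using (_⊎_; inj₁; inj₂)
open import Function using (_∘_; id; const)
open import Relation.Binary.Definitions using (DecidableEquality)
open import Relation.Binary.PropositionalEquality
  using (_≡_; _≢_; refl; sym; trans; cong; cong₂; module ≡-Reasoning)
  renaming (subst to ≡-subst)
open import Relation.Nullary using (yes; no)
open import Relation.Nullary.Decidable using (map′; _×-dec_)

module ŁukasiewiczArithmetic (N : ℕ) where

  infixr 5 _⇛_

  _⇛_ : ℕ → ℕ → ℕ
  x ⇛ y = N ⊓ ((N ∸ x) + y)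

  _⩒_ : ℕ → ℕ → ℕ
  x ⩒ y = (x ⇛ y) ⇛ y

  _⩑_ : ℕ → ℕ → ℕ
  x ⩑ y = N ∸ ((N ∸ x) ⩒ (N ∸ y))

  x⇛y≤N : ∀ x y → x ⇛ y ≤ N
  x⇛y≤N x y = m⊓n≤m N ((N ∸ x) + y)

  x≤y⇒x⇛y≡N : ∀ {x y} → x ≤ N → x ≤ y → x ⇛ y ≡ N
  x≤y⇒x⇛y≡N {x} {y} x≤N x≤y = m≤n⇒m⊓n≡m (begin
    N           ≡⟨ sym (m∸n+n≡m x≤N) ⟩
    (N ∸ x) + x ≤⟨ +-monoʳ-≤ (N ∸ x) x≤y ⟩
    (N ∸ x) + y ∎)
    where open ≤-Reasoning

  x⇛y≡N⇒x≤y : ∀ {x y} → x ≤ N → x ⇛ y ≡ N → x ≤ y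
  x⇛y≡N⇒x≤y {x} {y} x≤N x⇛y≡N = +-cancelˡ-≤ (N ∸ x) x y (begin
    (N ∸ x) + x ≡⟨ m∸n+n≡m x≤N ⟩
    N           ≡⟨ sym x⇛y≡N ⟩
    x ⇛ y       ≤⟨ m⊓n≤n N _ ⟩
    (N ∸ x) + y ∎)
    where open ≤-Reasoning

  N⇛y≡y : ∀ {y} → y ≤ N → N ⇛ y ≡ y
  N⇛y≡y y≤N rewrite n∸n≡0 N = m≥n⇒m⊓n≡n y≤N

  y≤x⇒x⇛y≡N∸x+y : ∀ {x y} → x ≤ N → y ≤ x → x ⇛ y ≡ (N ∸ x) + y
  y≤x⇒x⇛y≡N∸x+y {x} x≤N y≤x =
    m≥n⇒m⊓n≡n (≤-trans (+-monoʳ-≤ (N ∸ x) y≤x) (≤-reflexive (m∸n+n≡m x≤N)))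

  ⩒≡⊔ : ∀ {x y} → x ≤ N → y ≤ N → x ⩒ y ≡ x ⊔ y
  ⩒≡⊔ {x} {y} x≤N y≤N with ≤-total x y
  ... | inj₁ x≤y = begin
    (x ⇛ y) ⇛ y ≡⟨ cong (_⇛ y) (x≤y⇒x⇛y≡N x≤N x≤y) ⟩
    N ⇛ y       ≡⟨ N⇛y≡y y≤N ⟩
    y           ≡⟨ sym (m≤n⇒m⊔n≡n x≤y) ⟩
    x ⊔ y       ∎
    where open ≡-Reasoning
  ... | inj₂ y≤x = begin
    (x ⇛ y) ⇛ y                   ≡⟨ cong (_⇛ y) (y≤x⇒x⇛y≡N∸x+y x≤N y≤x) ⟩
    N ⊓ ((N ∸ ((N ∸ x) + y)) + y) ≡⟨ cong (λ z → N ⊓ (z + y)) (sym (∸-+-assoc N (N ∸ x) y)) ⟩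
    N ⊓ ((N ∸ (N ∸ x) ∸ y) + y)   ≡⟨ cong (λ z → N ⊓ ((z ∸ y) + y)) (m∸[m∸n]≡n x≤N) ⟩
    N ⊓ ((x ∸ y) + y)             ≡⟨ cong (N ⊓_) (m∸n+n≡m y≤x) ⟩
    N ⊓ x                         ≡⟨ m≥n⇒m⊓n≡n x≤N ⟩
    x                             ≡⟨ sym (m≥n⇒m⊔n≡m y≤x) ⟩
    x ⊔ y                         ∎
    where open ≡-Reasoning

  ⩑≡⊓ : ∀ {x y} → x ≤ N → y ≤ N → x ⩑ y ≡ x ⊓ y
  ⩑≡⊓ {x} {y} x≤N y≤N = begin
    N ∸ ((N ∸ x) ⩒ (N ∸ y))        ≡⟨ cong (N ∸_) (⩒≡⊔ (m∸n≤m N x) (m∸n≤m N y)) ⟩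
    N ∸ ((N ∸ x) ⊔ (N ∸ y))        ≡⟨ ∸-distribˡ-⊔-⊓ N (N ∸ x) (N ∸ y) ⟩
    (N ∸ (N ∸ x)) ⊓ (N ∸ (N ∸ y)) ≡⟨ cong₂ _⊓_ (m∸[m∸n]≡n x≤N) (m∸[m∸n]≡n y≤N) ⟩
    x ⊓ y                          ∎
    where open ≡-Reasoning

  _⇛[_]_ : ℕ → ℕ → ℕ → ℕ
  x ⇛[ zero ] y = y
  x ⇛[ suc k ] y = x ⇛ (x ⇛[ k ] y)

  N⇛[k]y≡y : ∀ k {y} → y ≤ N → N ⇛[ k ] y ≡ y
  N⇛[k]y≡y zero y≤N = refl
  N⇛[k]y≡y (suc k) y≤N rewrite N⇛[k]y≡y k y≤N = N⇛y≡y y≤N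

  x⇛[k]y≤N : ∀ k {x y} → y ≤ N → x ⇛[ k ] y ≤ N
  x⇛[k]y≤N zero y≤N = y≤N
  x⇛[k]y≤N (suc k) {x} {y} y≤N = x⇛y≤N x (x ⇛[ k ] y)

  -- Each implication from x < N adds at least N ∸ x ≥ 1.
  x<N⇒N⊓k≤x⇛[k]y : ∀ k {x y} → x < N → N ⊓ k ≤ x ⇛[ k ] y
  x<N⇒N⊓k≤x⇛[k]y zero x<N = ≤-trans (m⊓n≤n N 0) z≤n
  x<N⇒N⊓k≤x⇛[k]y (suc k) {x} {y} x<N = ⊓-glb (m⊓n≤m N (suc k)) (begin
    N ⊓ suc k             ≤⟨ ⊓-monoˡ-≤ (suc k) (n≤1+n N) ⟩
    suc (N ⊓ k)           ≤⟨ s≤s (x<N⇒N⊓k≤x⇛[k]y k x<N) ⟩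
    suc (x ⇛[ k ] y)      ≤⟨ +-monoˡ-≤ _ (m<n⇒0<n∸m x<N) ⟩
    (N ∸ x) + (x ⇛[ k ] y) ∎)
    where open ≤-Reasoning

  ⇛[N]≡N : ∀ {x y} → x ≤ N → y ≤ N → (x ≡ N → y ≡ N) → x ⇛[ N ] y ≡ N
  ⇛[N]≡N {x} {y} x≤N y≤N x≡N⇒y≡N with x ℕ.≟ N
  ... | yes refl = trans (N⇛[k]y≡y N y≤N) (x≡N⇒y≡N refl)
  ... | no x≢N = ≤-antisym (x⇛[k]y≤N N y≤N)
    (≤-trans (≤-reflexive (sym (⊓-idem N))) (x<N⇒N⊓k≤x⇛[k]y N (≤∧≢⇒< x≤N x≢N)))

infix 4 _≟_

_≟_ : DecidableEquality Form
var i ≟ var j = map′ (cong var) (λ { refl → refl }) (i ℕ.≟ j)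
(¬ A) ≟ (¬ B) = map′ (cong ¬_) (λ { refl → refl }) (A ≟ B)
(A ⇒ B) ≟ (C ⇒ D) = map′ (λ (p , q) → cong₂ _⇒_ p q) (λ { refl → refl , refl }) (A ≟ C ×-dec B ≟ D)
(A ≻ B) ≟ (C ≻ D) = map′ (λ (p , q) → cong₂ _≻_ p q) (λ { refl → refl , refl }) (A ≟ C ×-dec B ≟ D)
var _ ≟ (¬ _) = no λ ()
var _ ≟ (_ ⇒ _) = no λ ()
var _ ≟ (_ ≻ _) = no λ ()
(¬ _) ≟ var _ = no λ ()
(¬ _) ≟ (_ ⇒ _) = no λ ()
(¬ _) ≟ (_ ≻ _) = no λ ()
(_ ⇒ _) ≟ var _ = no λ ()
(_ ⇒ _) ≟ (¬ _) = no λ ()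
(_ ⇒ _) ≟ (_ ≻ _) = no λ ()
(_ ≻ _) ≟ var _ = no λ ()
(_ ≻ _) ≟ (¬ _) = no λ ()
(_ ≻ _) ≟ (_ ⇒ _) = no λ ()

atoms : Form → List Form
atoms (var i) = var i ∷ []
atoms (¬ F) = atoms F
atoms (F ⇒ G) = atoms F ++ atoms G
atoms (F ≻ G) = (F ≻ G) ∷ []

indexOf : List Form → Form → ℕ
indexOf [] A = 0
indexOf (B ∷ L) A with B ≟ A
... | yes _ = 0
... | no _ = suc (indexOf L A)

-- 𝐭 is a junk value for indices out of range.
atomAt : List Form → ℕ → Form
atomAt [] k = 𝐭
atomAt (B ∷ L) zero = B
atomAt (B ∷ L) (suc k) = atomAt L k

atomAt-indexOf : ∀ L {A} → A ∈ L → atomAt L (indexOf L A) ≡ A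
atomAt-indexOf (B ∷ L) {A} A∈ with B ≟ A | A∈
... | yes B≡A | _ = B≡A
... | no B≢A | here refl = ⊥-elim (B≢A refl)
... | no B≢A | there A∈L = atomAt-indexOf L A∈L

skeleton : List Form → Form → PForm
skeleton L (var i) = pvar (indexOf L (var i))
skeleton L (¬ F) = p¬ (skeleton L F)
skeleton L (F ⇒ G) = skeleton L F p⇒ skeleton L G
skeleton L (F ≻ G) = pvar (indexOf L (F ≻ G))

subst-skeleton : ∀ L F → (∀ {A} → A ∈ atoms F → A ∈ L) → subst (atomAt L) (skeleton L F) ≡ F
subst-skeleton L (var i) atoms⊆L = atomAt-indexOf L (atoms⊆L (here refl))
subst-skeleton L (¬ F) atoms⊆L = cong ¬_ (subst-skeleton L F atoms⊆L)
subst-skeleton L (F ⇒ G) atoms⊆L = cong₂ _⇒_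
  (subst-skeleton L F (atoms⊆L ∘ ∈-++⁺ˡ))
  (subst-skeleton L G (atoms⊆L ∘ ∈-++⁺ʳ (atoms F)))
subst-skeleton L (F ≻ G) atoms⊆L = atomAt-indexOf L (atoms⊆L (here refl))

⋀ : List Form → Form
⋀ [] = 𝐭
⋀ (A ∷ Γ) = A ∧ ⋀ Γ

_⇒[_]_ : Form → ℕ → Form → Form
P ⇒[ zero ] Q = Q
P ⇒[ suc k ] Q = P ⇒ (P ⇒[ k ] Q)

∀-fromℕ-inject₁ : ∀ {k} {P : Fin (suc k) → Set} → P (fromℕ k) → (∀ j → P (inject₁ j)) → ∀ i → P i
∀-fromℕ-inject₁ {zero} Plast _ Fin.zero = Plast
∀-fromℕ-inject₁ {suc k} _ Pinj Fin.zero = Pinj Fin.zero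
∀-fromℕ-inject₁ {suc k} {P} Plast Pinj (Fin.suc i) = ∀-fromℕ-inject₁ {P = P ∘ Fin.suc} Plast (Pinj ∘ Fin.suc) i

module Semantics (N : ℕ) where
  open ŁukasiewiczArithmetic N public

  m : ℕ
  m = suc N

  Valuation : Set
  Valuation = Form → Fin m

  ⟦_⟧ : Form → Valuation → ℕ
  ⟦ var i ⟧ w = toℕ (w (var i))
  ⟦ ¬ F ⟧ w = N ∸ ⟦ F ⟧ w
  ⟦ F ⇒ G ⟧ w = ⟦ F ⟧ w ⇛ ⟦ G ⟧ w
  ⟦ F ≻ G ⟧ w = toℕ (w (F ≻ G))

  infix 4 _⊨_

  _⊨_ : Valuation → Form → Set
  w ⊨ F = ⟦ F ⟧ w ≡ N

  Crisp : Valuation → Form → Set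
  Crisp w F = w ⊨ F ⊎ ⟦ F ⟧ w ≡ 0

  toℕ≤N : (x : Fin m) → toℕ x ≤ N
  toℕ≤N x = s≤s⁻¹ (toℕ<n x)

  ⟦⟧≤N : ∀ F w → ⟦ F ⟧ w ≤ N
  ⟦⟧≤N (var i) w = toℕ≤N (w (var i))
  ⟦⟧≤N (¬ F) w = m∸n≤m N (⟦ F ⟧ w)
  ⟦⟧≤N (F ⇒ G) w = x⇛y≤N (⟦ F ⟧ w) (⟦ G ⟧ w)
  ⟦⟧≤N (F ≻ G) w = toℕ≤N (w (F ≻ G))

  eval≤N : ∀ v ψ → eval m v ψ ≤ N
  eval≤N v (pvar i) = toℕ≤N (v i)
  eval≤N v (p¬ ψ) = m∸n≤m N (eval m v ψ)
  eval≤N v (ψ p⇒ χ) = x⇛y≤N (eval m v ψ) (eval m v χ)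

  value : Valuation → Form → Fin m
  value w F = fromℕ< (s≤s (⟦⟧≤N F w))

  ⟦subst⟧ : ∀ σ ψ w → ⟦ subst σ ψ ⟧ w ≡ eval m (value w ∘ σ) ψ
  ⟦subst⟧ σ (pvar i) w = sym (toℕ-fromℕ< _)
  ⟦subst⟧ σ (p¬ ψ) w = cong (N ∸_) (⟦subst⟧ σ ψ w)
  ⟦subst⟧ σ (ψ p⇒ χ) w = cong₂ _⇛_ (⟦subst⟧ σ ψ w) (⟦subst⟧ σ χ w)

  ⟦skeleton⟧ : ∀ L F v → eval m v (skeleton L F) ≡ ⟦ F ⟧ (v ∘ indexOf L)
  ⟦skeleton⟧ L (var i) v = refl
  ⟦skeleton⟧ L (¬ F) v = cong (N ∸_) (⟦skeleton⟧ L F v)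
  ⟦skeleton⟧ L (F ⇒ G) v = cong₂ _⇛_ (⟦skeleton⟧ L F v) (⟦skeleton⟧ L G v)
  ⟦skeleton⟧ L (F ≻ G) v = refl

  ⊨⇒ : ∀ w A B → ⟦ A ⟧ w ≤ ⟦ B ⟧ w → w ⊨ A ⇒ B
  ⊨⇒ w A B = x≤y⇒x⇛y≡N (⟦⟧≤N A w)

  ⊨⇒⁻ : ∀ w A B → w ⊨ A ⇒ B → ⟦ A ⟧ w ≤ ⟦ B ⟧ w
  ⊨⇒⁻ w A B = x⇛y≡N⇒x≤y (⟦⟧≤N A w)

  ⊨-mp : ∀ w A B → w ⊨ A ⇒ B → w ⊨ A → w ⊨ B
  ⊨-mp w A B ⊨A⇒B ⊨A =
    ≤-antisym (⟦⟧≤N B w) (≤-trans (≤-reflexive (sym ⊨A)) (⊨⇒⁻ w A B ⊨A⇒B))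

  ⟦∧⟧ : ∀ A B w → ⟦ A ∧ B ⟧ w ≡ ⟦ A ⟧ w ⊓ ⟦ B ⟧ w
  ⟦∧⟧ A B w = ⩑≡⊓ (⟦⟧≤N A w) (⟦⟧≤N B w)

  ⟦⋀⟧≤ : ∀ {w A Γ} → A ∈ Γ → ⟦ ⋀ Γ ⟧ w ≤ ⟦ A ⟧ w
  ⟦⋀⟧≤ {w} {A} {A ∷ Γ} (here refl) = ≤-trans (≤-reflexive (⟦∧⟧ A (⋀ Γ) w)) (m⊓n≤m _ _)
  ⟦⋀⟧≤ {w} {A} {B ∷ Γ} (there A∈Γ) =
    ≤-trans (≤-reflexive (⟦∧⟧ B (⋀ Γ) w)) (≤-trans (m⊓n≤n _ _) (⟦⋀⟧≤ A∈Γ))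

  ≤⟦⋀⟧ : ∀ {w c} Γ → c ≤ N → All (λ A → c ≤ ⟦ A ⟧ w) Γ → c ≤ ⟦ ⋀ Γ ⟧ w
  ≤⟦⋀⟧ {w} [] c≤N [] = ≤-trans c≤N (≤-reflexive (sym (x≤y⇒x⇛y≡N (⟦⟧≤N (var 0) w) ≤-refl)))
  ≤⟦⋀⟧ {w} (A ∷ Γ) c≤N (c≤A ∷ c≤Γ) =
    ≤-trans (⊓-glb c≤A (≤⟦⋀⟧ Γ c≤N c≤Γ)) (≤-reflexive (sym (⟦∧⟧ A (⋀ Γ) w)))

  eval-p∨ : ∀ v ψ χ → eval m v (ψ p∨ χ) ≡ eval m v ψ ⊔ eval m v χ
  eval-p∨ v ψ χ = ⩒≡⊔ (eval≤N v ψ) (eval≤N v χ)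

  eval-orList-top : ∀ v {x ys y} → y ∈ x ∷ ys → eval m v y ≡ N → eval m v (orList x ys) ≡ N
  eval-orList-top v {x} {[]} (here refl) ⊨y = ⊨y
  eval-orList-top v {x} {y ∷ ys} (here refl) ⊨x =
    trans (eval-p∨ v x (orList y ys)) (trans (cong (_⊔ _) ⊨x) (m≥n⇒m⊔n≡m (eval≤N v (orList y ys))))
  eval-orList-top v {x} {y ∷ ys} (there z∈) ⊨z =
    trans (eval-p∨ v x (orList y ys)) (trans (cong (_ ⊔_) (eval-orList-top v z∈ ⊨z)) (m≤n⇒m⊔n≡n (eval≤N v x)))

  eval-orList-zero : ∀ v x ys → (∀ {y} → y ∈ x ∷ ys → eval m v y ≡ 0) → eval m v (orList x ys) ≡ 0
  eval-orList-zero v x [] all-0 = all-0 (here refl)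
  eval-orList-zero v x (y ∷ ys) all-0 =
    trans (eval-p∨ v x (orList y ys)) (cong₂ _⊔_ (all-0 (here refl)) (eval-orList-zero v y ys (all-0 ∘ there)))

  ⟦⇒[]⟧ : ∀ k P Q w → ⟦ P ⇒[ k ] Q ⟧ w ≡ ⟦ P ⟧ w ⇛[ k ] ⟦ Q ⟧ w
  ⟦⇒[]⟧ zero P Q w = refl
  ⟦⇒[]⟧ (suc k) P Q w = cong (⟦ P ⟧ w ⇛_) (⟦⇒[]⟧ k P Q w)

  ⊨⇒[N] : ∀ {w} P Q → (w ⊨ P → w ⊨ Q) → w ⊨ P ⇒[ N ] Q
  ⊨⇒[N] {w} P Q ⊨P→⊨Q = trans (⟦⇒[]⟧ N P Q w) (⇛[N]≡N (⟦⟧≤N P w) (⟦⟧≤N Q w) ⊨P→⊨Q)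

  ⊨impChain : ∀ {w} k hs c → (∀ i → Crisp w (hs i)) → ((∀ i → w ⊨ hs i) → w ⊨ c) →
              w ⊨ impChain k hs c
  ⊨impChain zero hs c _ ⊨hs→⊨c = ⊨hs→⊨c (λ ())
  ⊨impChain {w} (suc k) hs c crisp ⊨hs→⊨c = ⊨⇒ w (hs (fromℕ k)) rest (h≤rest (crisp (fromℕ k)))
    where
    rest : Form
    rest = impChain k (hs ∘ inject₁) c

    h≤rest : Crisp w (hs (fromℕ k)) → ⟦ hs (fromℕ k) ⟧ w ≤ ⟦ rest ⟧ w
    h≤rest (inj₂ ⟦h⟧≡0) = ≤-trans (≤-reflexive ⟦h⟧≡0) z≤n
    h≤rest (inj₁ ⊨h) = ≤-reflexive (trans ⊨h (sym
      (⊨impChain k (hs ∘ inject₁) c (crisp ∘ inject₁) (⊨hs→⊨c ∘ ∀-fromℕ-inject₁ ⊨h))))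

  ⊨impChain⁻ : ∀ {w} k hs c → w ⊨ impChain k hs c → (∀ i → w ⊨ hs i) → w ⊨ c
  ⊨impChain⁻ zero hs c ⊨c _ = ⊨c
  ⊨impChain⁻ {w} (suc k) hs c ⊨chain ⊨hs = ⊨impChain⁻ k (hs ∘ inject₁) c
    (⊨-mp w (hs (fromℕ k)) (impChain k (hs ∘ inject₁) c) ⊨chain (⊨hs (fromℕ k))) (⊨hs ∘ inject₁)

module Provability (N : ℕ) (J : Fin (suc N) → PForm) where
  open Semantics N

  infix 2 ⊢_

  ⊢_ : Form → Set
  ⊢ F = LCR⊢ m J F

  valid⇒⊢ : ∀ F → (∀ w → w ⊨ F) → ⊢ F
  valid⇒⊢ F ⊨F = ≡-subst ⊢_ (subst-skeleton L F id)
    (taut (skeleton L F) (λ v → trans (⟦skeleton⟧ L F v) (⊨F (v ∘ indexOf L))) (atomAt L))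
    where
    L : List Form
    L = atoms F

  ⊢-mp-power : ∀ k {P Q} → ⊢ P → ⊢ P ⇒[ k ] Q → ⊢ Q
  ⊢-mp-power zero _ ⊢Q = ⊢Q
  ⊢-mp-power (suc k) ⊢P ⊢P⇒Q = ⊢-mp-power k ⊢P (mp ⊢P ⊢P⇒Q)

  ⊨⇒⊢ : ∀ Ps Q → All ⊢_ Ps → (∀ w → All (w ⊨_) Ps → w ⊨ Q) → ⊢ Q
  ⊨⇒⊢ [] Q [] ⊨Q = valid⇒⊢ Q (λ w → ⊨Q w [])
  ⊨⇒⊢ (P ∷ Ps) Q (⊢P ∷ ⊢Ps) Ps⊨Q = ⊢-mp-power N ⊢P
    (⊨⇒⊢ Ps (P ⇒[ N ] Q) ⊢Ps (λ w ⊨Ps → ⊨⇒[N] P Q (λ ⊨P → Ps⊨Q w (⊨P ∷ ⊨Ps))))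

  ⊢≻⋀ : ∀ φ Γ → ⊢ ⋀ (map (φ ≻_) Γ) ⇒ (φ ≻ ⋀ Γ)
  ⊢≻⋀ φ [] = ⊨⇒⊢ (φ ≻ 𝐭 ∷ []) _ (A3 φ ∷ []) λ { w (⊨φ≻𝐭 ∷ []) →
    ⊨⇒ w 𝐭 (φ ≻ 𝐭) (≤-trans (⟦⟧≤N 𝐭 w) (≤-reflexive (sym ⊨φ≻𝐭))) }
  ⊢≻⋀ φ (A ∷ Γ) = ⊨⇒⊢ (_ ∷ _ ∷ []) _ (A2 φ A (⋀ Γ) ∷ ⊢≻⋀ φ Γ ∷ []) λ { w (⊨A2 ∷ ⊨≻⋀Γ ∷ []) →
    ⊨⇒ w ((φ ≻ A) ∧ ⋀ ≻Γ) (φ ≻ (A ∧ ⋀ Γ)) (begin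
      ⟦ (φ ≻ A) ∧ ⋀ ≻Γ ⟧ w          ≡⟨ ⟦∧⟧ (φ ≻ A) (⋀ ≻Γ) w ⟩
      ⟦ φ ≻ A ⟧ w ⊓ ⟦ ⋀ ≻Γ ⟧ w      ≤⟨ ⊓-monoʳ-≤ _ (⊨⇒⁻ w (⋀ ≻Γ) (φ ≻ ⋀ Γ) ⊨≻⋀Γ) ⟩
      ⟦ φ ≻ A ⟧ w ⊓ ⟦ φ ≻ ⋀ Γ ⟧ w   ≡⟨ sym (⟦∧⟧ (φ ≻ A) (φ ≻ ⋀ Γ) w) ⟩
      ⟦ (φ ≻ A) ∧ (φ ≻ ⋀ Γ) ⟧ w     ≤⟨ ⊨⇒⁻ w ((φ ≻ A) ∧ (φ ≻ ⋀ Γ)) (φ ≻ (A ∧ ⋀ Γ)) ⊨A2 ⟩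
      ⟦ φ ≻ (A ∧ ⋀ Γ) ⟧ w           ∎) }
    where
    open ≤-Reasoning

    ≻Γ : List Form
    ≻Γ = map (φ ≻_) Γ

module Operators (N : ℕ) (J : Fin (suc N) → PForm) (isJ : IsJ (suc N) J) where
  open Semantics N

  J-self : ∀ x → eval m (const x) (J x) ≡ N
  J-self x with x Fin.≟ x | isJ x x
  ... | yes _ | ⟦J⟧≡N = ⟦J⟧≡N
  ... | no x≢x | _ = ⊥-elim (x≢x refl)

  J-other : ∀ {a x} → a ≢ x → eval m (const x) (J a) ≡ 0
  J-other {a} {x} a≢x with a Fin.≟ x | isJ a x
  ... | yes a≡x | _ = ⊥-elim (a≢x a≡x)
  ... | no _ | ⟦J⟧≡0 = ⟦J⟧≡0

  Js≥ : Fin m → List PForm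
  Js≥ c = J c ∷ map J (filter (c Fin.<?_) (allFin m))

  ∈-Js≥⁺ : ∀ {c d} → c Fin.≤ d → J d ∈ Js≥ c
  ∈-Js≥⁺ {c} {d} c≤d with m≤n⇒m<n∨m≡n c≤d
  ... | inj₁ c<d = there (∈-map⁺ J (∈-filter⁺ (c Fin.<?_) (∈-allFin d) c<d))
  ... | inj₂ c≡d rewrite toℕ-injective c≡d = here refl

  ∈-Js≥⁻ : ∀ {c ψ} → ψ ∈ Js≥ c → ∃ λ d → c Fin.≤ d × ψ ≡ J d
  ∈-Js≥⁻ {c} (here refl) = c , ≤-refl , refl
  ∈-Js≥⁻ {c} (there ψ∈) with ∈-map⁻ J ψ∈
  ... | d , d∈ , refl = d , <⇒≤ (proj₂ (∈-filter⁻ (c Fin.<?_) {xs = allFin m} d∈)) , refl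

  Ipure-top : ∀ {c x} → c Fin.≤ x → eval m (const x) (Ipure m J c) ≡ N
  Ipure-top {c} {x} c≤x = eval-orList-top (const x) (∈-Js≥⁺ c≤x) (J-self x)

  Ipure-zero : ∀ {c x} → x Fin.< c → eval m (const x) (Ipure m J c) ≡ 0
  Ipure-zero {c} {x} x<c = eval-orList-zero (const x) (J c) _ J≥c-zero
    where
    J≥c-zero : ∀ {ψ} → ψ ∈ Js≥ c → eval m (const x) ψ ≡ 0
    J≥c-zero ψ∈ with ∈-Js≥⁻ ψ∈
    ... | d , c≤d , refl = J-other λ d≡x → <⇒≱ x<c (≤-trans c≤d (≤-reflexive (cong toℕ d≡x)))

  ⟦𝐈⟧ : ∀ c X w → ⟦ 𝐈 m J c X ⟧ w ≡ eval m (const (value w X)) (Ipure m J c)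
  ⟦𝐈⟧ c X w = ⟦subst⟧ (const X) (Ipure m J c) w

  𝐈-intro : ∀ {w c} X → toℕ c ≤ ⟦ X ⟧ w → w ⊨ 𝐈 m J c X
  𝐈-intro {w} {c} X c≤X =
    trans (⟦𝐈⟧ c X w) (Ipure-top (≤-trans c≤X (≤-reflexive (sym (toℕ-fromℕ< _)))))

  𝐈-zero : ∀ {w c} X → ⟦ X ⟧ w < toℕ c → ⟦ 𝐈 m J c X ⟧ w ≡ 0
  𝐈-zero {w} {c} X X<c =
    trans (⟦𝐈⟧ c X w) (Ipure-zero (≤-trans (s≤s (≤-reflexive (toℕ-fromℕ< _))) X<c))

  𝐈-crisp : ∀ {w} c X → Crisp w (𝐈 m J c X)
  𝐈-crisp {w} c X with toℕ c ≤? ⟦ X ⟧ w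
  ... | yes c≤X = inj₁ (𝐈-intro X c≤X)
  ... | no c≰X = inj₂ (𝐈-zero X (≰⇒> c≰X))

  -- In the second case ⟦ 𝐈 m J c X ⟧ w is both N and 0, so N = 0 and c = 0.
  𝐈-elim : ∀ {w c} X → w ⊨ 𝐈 m J c X → toℕ c ≤ ⟦ X ⟧ w
  𝐈-elim {w} {c} X ⊨𝐈 with toℕ c ≤? ⟦ X ⟧ w
  ... | yes c≤X = c≤X
  ... | no c≰X = ≤-trans (toℕ≤N c) (≤-trans (≤-reflexive (trans (sym ⊨𝐈) (𝐈-zero X (≰⇒> c≰X)))) z≤n)

module Regrouping (N : ℕ) (J : Fin (suc N) → PForm) (isJ : IsJ (suc N) J)
                  {n : ℕ} (as : Fin n → Fin (suc N)) (a : Fin (suc N))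
                  (φ : Form) (γs : Fin n → Form) (γ : Form) where
  open Semantics N
  open Provability N J
  open Operators N J isJ

  -- aᵢ m j = opposite j, so the weight as i occurs as aᵢ m (opposite (as i)).
  group : Fin m → List (Fin n)
  group j = filter (λ i → as i Fin.≟ aᵢ m j) (allFin n)

  γ̂ : Fin m → Form
  γ̂ j = ⋀ (map γs (group j))

  ∈-group : ∀ i → i ∈ group (opposite (as i))
  ∈-group i = ∈-filter⁺ (λ i′ → as i′ Fin.≟ aᵢ m (opposite (as i))) (∈-allFin i)
    (sym (opposite-involutive (as i)))

  ∈-group⁻ : ∀ {i} j → i ∈ group j → as i ≡ aᵢ m j
  ∈-group⁻ j i∈ = proj₂ (∈-filter⁻ (λ i′ → as i′ Fin.≟ aᵢ m j) {xs = allFin n} i∈)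

  regrouped-premise : ∀ b → ⊢ impChain n (λ i → 𝐈 m J (as i ⊙ b) (γs i)) (𝐈 m J (a ⊙ b) γ) →
                  ⊢ impChain m (λ j → 𝐈 m J (aᵢ m j ⊙ b) (γ̂ j)) (𝐈 m J (a ⊙ b) γ)
  regrouped-premise b ⊢hyp = ⊨⇒⊢ (impChain n Hs C ∷ []) (impChain m Ĥs C) (⊢hyp ∷ []) λ { w (⊨hyp ∷ []) →
    ⊨impChain m Ĥs C (λ j → 𝐈-crisp (aᵢ m j ⊙ b) (γ̂ j)) λ ⊨Ĥs →
    ⊨impChain⁻ n Hs C ⊨hyp λ i → 𝐈-intro (γs i) (weight≤γ i (⊨Ĥs (opposite (as i)))) }
    where
    Hs : Fin n → Form
    Hs i = 𝐈 m J (as i ⊙ b) (γs i)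

    Ĥs : Fin m → Form
    Ĥs j = 𝐈 m J (aᵢ m j ⊙ b) (γ̂ j)

    C : Form
    C = 𝐈 m J (a ⊙ b) γ

    weight≤γ : ∀ {w} i → w ⊨ Ĥs (opposite (as i)) → toℕ (as i ⊙ b) ≤ ⟦ γs i ⟧ w
    weight≤γ {w} i ⊨Ĥ = begin
      toℕ (as i ⊙ b)                   ≡⟨ cong (λ c → toℕ (c ⊙ b)) (sym (opposite-involutive (as i))) ⟩
      toℕ (aᵢ m (opposite (as i)) ⊙ b) ≤⟨ 𝐈-elim (γ̂ (opposite (as i))) ⊨Ĥ ⟩
      ⟦ γ̂ (opposite (as i)) ⟧ w        ≤⟨ ⟦⋀⟧≤ (∈-map⁺ γs (∈-group i)) ⟩
      ⟦ γs i ⟧ w                       ∎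
      where open ≤-Reasoning

  ⋀≻γs⇒≻γ̂ : Fin m → Form
  ⋀≻γs⇒≻γ̂ j = ⋀ (map (φ ≻_) (map γs (group j))) ⇒ (φ ≻ γ̂ j)

  ungrouped-conclusion : ⊢ impChain m (λ j → 𝐈 m J (aᵢ m j) (φ ≻ γ̂ j)) (𝐈 m J a (φ ≻ γ)) →
               ⊢ impChain n (λ i → 𝐈 m J (as i) (φ ≻ γs i)) (𝐈 m J a (φ ≻ γ))
  ungrouped-conclusion ⊢R = ⊨⇒⊢ (impChain m Ĥs C ∷ map ⋀≻γs⇒≻γ̂ (allFin m)) (impChain n Hs C)
    (⊢R ∷ map⁺ {xs = allFin m} {f = ⋀≻γs⇒≻γ̂} (All.tabulate λ {j} _ → ⊢≻⋀ φ (map γs (group j))))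
    λ { w (⊨R ∷ ⊨⋀≻γs⇒≻γ̂s) →
    ⊨impChain n Hs C (λ i → 𝐈-crisp (as i) (φ ≻ γs i)) λ ⊨Hs →
    ⊨impChain⁻ m Ĥs C ⊨R λ j → 𝐈-intro (φ ≻ γ̂ j)
      (weight≤≻γ̂ j (weight≤≻γ j ⊨Hs) (All.lookup ⊨⋀≻γs⇒≻γ̂s (∈-map⁺ ⋀≻γs⇒≻γ̂ (∈-allFin j)))) }
    where
    Hs : Fin n → Form
    Hs i = 𝐈 m J (as i) (φ ≻ γs i)

    Ĥs : Fin m → Form
    Ĥs j = 𝐈 m J (aᵢ m j) (φ ≻ γ̂ j)

    C : Form
    C = 𝐈 m J a (φ ≻ γ)

    weight≤≻γ : ∀ {w} j → (∀ i → w ⊨ Hs i) → ∀ {i} → i ∈ group j → toℕ (aᵢ m j) ≤ ⟦ φ ≻ γs i ⟧ w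
    weight≤≻γ j ⊨Hs {i} i∈ = ≤-trans (≤-reflexive (cong toℕ (sym (∈-group⁻ j i∈)))) (𝐈-elim (φ ≻ γs i) (⊨Hs i))

    weight≤≻γ̂ : ∀ {w} j → (∀ {i} → i ∈ group j → toℕ (aᵢ m j) ≤ ⟦ φ ≻ γs i ⟧ w) →
                w ⊨ ⋀≻γs⇒≻γ̂ j → toℕ (aᵢ m j) ≤ ⟦ φ ≻ γ̂ j ⟧ w
    weight≤≻γ̂ {w} j weight≤≻γs ⊨⋀≻γs⇒≻γ̂ = begin
      toℕ (aᵢ m j)  ≤⟨ ≤⟦⋀⟧ ≻γs (toℕ≤N (aᵢ m j)) (map⁺ (map⁺ (All.tabulate weight≤≻γs))) ⟩
      ⟦ ⋀ ≻γs ⟧ w   ≤⟨ ⊨⇒⁻ w (⋀ ≻γs) (φ ≻ γ̂ j) ⊨⋀≻γs⇒≻γ̂ ⟩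
      ⟦ φ ≻ γ̂ j ⟧ w ∎
      where
      open ≤-Reasoning

      ≻γs : List Form
      ≻γs = map (φ ≻_) (map γs (group j))

lemma2p6 : (m : ℕ) → 2 ≤ m → (J : Fin m → PForm) → IsJ m J →
    (n : ℕ) → 1 ≤ n → (as : Fin n → Fin m) (a : Fin m)
    (φ : Form) (γs : Fin n → Form) (γ : Form) →
    ((b : Fin m) → LCR⊢ m J
       (impChain n (λ i → 𝐈 m J (as i ⊙ b) (γs i)) (𝐈 m J (a ⊙ b) γ))) →
    LCR⊢ m J (impChain n (λ i → 𝐈 m J (as i) (φ ≻ γs i)) (𝐈 m J a (φ ≻ γ)))
lemma2p6 (suc N) _ J isJ n _ as a φ γs γ hyp =
  ungrouped-conclusion (Ra a φ γ̂ γ (λ b → regrouped-premise b (hyp b)))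
  where open Regrouping N J isJ as a φ γs γ
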